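{- Let $p\ne2,5$ be a prime and let $\sum_{i=0}^\infty a_it^i\in\mathbb{C}_p[[t]]$ have integral coefficients ($v(a_i)\ge0$). Put $f(t)=\sum_{i=0}^\infty\frac{a_i}{i+1}t^{i+1}$. If $v(a_0)=0$, then $\mathrm{New}_1(f)=\emptyset$ and $\mathrm{New}_{1/2}(f)\subset[1,3]$. If $v(a_1)=0$ or $v(a_2)=0$, then $\mathrm{New}_1(f),\mathrm{New}_{1/2}(f)\subset[1,3]$.
   Context: $v$ is the valuation on $\mathbb{C}_p$ with $v(p)=1$ and $v(0)=\infty$. For a power series $F(t)=\sum_{u\ge0}c_ut^u$ and positive rational $m$, $\mathrm{New}_m(F)\subset\mathbb{R}$ is the convex hull of the set of $u\in\mathbb{Z}_{\ge0}$ for which there exists a rational $w\ge m$ such that $v(c_u)+wu\le v(c_{u''})+wu''$ for all $u''$ and there exists $u'\ne u$ with $v(c_u)+wu=v(c_{u'})+wu'$. -}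

module Defs where

open import Level using (Level; _⊔_) renaming (suc to lsuc)
open import Data.Nat using (ℕ; zero; suc)
open import Data.Rational using (ℚ; _≤_)
import Data.Rational as Q
open import Data.Product using (Σ; ∃; _×_; _,_)
open import Relation.Binary.PropositionalEquality using (_≡_; _≢_)
open import Relation.Nullary using (¬_)
open import Data.Integer using (+_)
open import Algebra.Bundles using (CommutativeRing)

ℕ→ℚ : ℕ → ℚ
ℕ→ℚ n = (+ n) Q./ 1

data ℚ∞ : Set where
  fin : ℚ → ℚ∞
  ∞   : ℚ∞

infixl 6 _+∞_
_+∞_ : ℚ∞ → ℚ∞ → ℚ∞
fin a +∞ fin b = fin (a Q.+ b)
fin _ +∞ ∞     = ∞
∞     +∞ _     = ∞

infix 4 _≤∞_
data _≤∞_ : ℚ∞ → ℚ∞ → Set where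
  fin≤fin : ∀ {a b} → a ≤ b → fin a ≤∞ fin b
  _≤∞∞    : ∀ x → x ≤∞ ∞

min∞ : ℚ∞ → ℚ∞ → ℚ∞
min∞ (fin a) (fin b) = fin (a Q.⊓ b)
min∞ (fin a) ∞ = fin a
min∞ ∞ y = y

module _ {c ℓ} (R : CommutativeRing c ℓ) where
  open CommutativeRing R
  ι : ℕ → Carrier
  ι zero    = 0#
  ι (suc n) = 1# + ι n

-- A field with a (rank-one, ℚ-valued) non-archimedean valuation v normalised by
-- v(p) = 1, v(0) = ∞.  ℂ_p (with its valuation) is such a structure; since ℂ_p
-- cannot be constructed in agda-stdlib we quantify over all such structures.
record ValuedField (p : ℕ) (c ℓ : Level) : Set (lsuc (c ⊔ ℓ)) where
  field
    cring : CommutativeRing c ℓ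
  open CommutativeRing cring public
  field
    _⁻¹      : Carrier → Carrier
    inverse  : ∀ x → x ≉ 0# → x * x ⁻¹ ≈ 1#
    v        : Carrier → ℚ∞
    v-cong   : ∀ {x y} → x ≈ y → v x ≡ v y
    v-zero   : ∀ x → v x ≡ ∞ → x ≈ 0#
    v-0      : v 0# ≡ ∞
    v-mul    : ∀ x y → v (x * y) ≡ v x +∞ v y
    v-add    : ∀ x y → min∞ (v x) (v y) ≤∞ v (x + y)
    v-p      : v (ι cring p) ≡ fin Q.1ℚ

-- Power series over K are coefficient sequences ℕ → K.
module _ {p c ℓ} (K : ValuedField p c ℓ) where
  open ValuedField K

  antideriv : (ℕ → Carrier) → (ℕ → Carrier)
  antideriv a zero    = 0#
  antideriv a (suc i) = a i * (ι cring (suc i)) ⁻¹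

  wu : ℚ → ℕ → ℚ∞
  wu w u = fin (w Q.* ℕ→ℚ u)

  -- u belongs to the generating set of New_m(F)
  NewPt : ℚ → (ℕ → Carrier) → ℕ → Set
  NewPt m F u = Σ ℚ λ w → m ≤ w
      × (∀ u'' → v (F u) +∞ wu w u ≤∞ v (F u'') +∞ wu w u'')
      × Σ ℕ λ u' → u' ≢ u × v (F u) +∞ wu w u ≡ v (F u') +∞ wu w u'

  -- x ∈ New_m(F) (convex hull in ℝ, tested at rational points x)
  _∈New[_]_ : ℚ → ℚ → (ℕ → Carrier) → Set
  x ∈New[ m ] F = Σ ℕ λ u₁ → Σ ℕ λ u₂ → NewPt m F u₁ × NewPt m F u₂
      × (ℕ→ℚ u₁ ≤ x) × (x ≤ ℕ→ℚ u₂)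

  New⊆ : ℚ → (ℕ → Carrier) → ℚ → ℚ → Set
  New⊆ m F a b = ∀ x → x ∈New[ m ] F → (a ≤ x) × (x ≤ b)

  NewEmpty : ℚ → (ℕ → Carrier) → Set
  NewEmpty m F = ∀ x → ¬ (x ∈New[ m ] F)

{-# OPTIONS --safe #-}
-- Write F for the antiderivative.  Since v(u) = k for some k with p^k ∣ u, integrality gives
-- v(F u) ≥ -k, while a unit coefficient a_{i₀} gives v(F(i₀ + 1)) ≤ 0, and v(F 0) = ∞.  Hence
-- u = i₀ + 1 + j can only minimise v(F u) + w u if w j ≤ k.  For an odd prime, p^k ∣ u forces
-- k + 2 ≤ u, and for p ∉ {2, 5} also 2k + 4 ≤ u when u ≥ 4.  With w ≥ 1/2 and i₀ ≤ 2 this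
-- keeps every minimiser in [1, 3]; with w ≥ 1 and i₀ = 0 the minimiser is unique (u = 1), so
-- no two vertices tie and New₁ is empty.
module Submission where

open import Defs
open import Level using (Level)
open import Data.Nat using (ℕ)
open import Data.Nat.Primality using (Prime)
open import Data.Rational using (ℚ; 0ℚ; 1ℚ; ½)
open import Data.Product using (_×_)
open import Data.Sum using (_⊎_)
open import Relation.Binary.PropositionalEquality using (_≡_; _≢_)

open import Function using (_∘_)
open import Data.Empty using (⊥; ⊥-elim)
open import Data.Product using (∃-syntax; _,_; proj₁; proj₂)
open import Data.Sum using (inj₁; inj₂; [_,_]′)
open import Relation.Nullary using (¬_; yes; no)
open import Relation.Binary.Definitions using (tri<; tri≈; tri>)
open import Relation.Binary.PropositionalEquality using (refl; sym; trans; cong; cong₂; subst; subst₂; module ≡-Reasoning)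

module _ where
  open import Data.Nat
  open import Data.Nat.Properties
  open import Data.Nat.Divisibility using (_∣_; ∣⇒≤)
  open import Data.Nat.Primality using (prime⇒irreducible; euclidsLemma; prime?; prime[2]; ¬prime[1])
  open import Data.Nat.Coprimality using (Coprime)
  open import Data.Nat.Tactic.RingSolver using (solve-∀)
  open import Relation.Nullary.Decidable using (from-yes)
  open ≤-Reasoning

  prime≢2⇒3≤ : ∀ {p} → Prime p → p ≢ 2 → 3 ≤ p
  prime≢2⇒3≤ {2} _ p≢2 = ⊥-elim (p≢2 refl)
  prime≢2⇒3≤ {suc (suc (suc _))} _ _ = s≤s (s≤s (s≤s z≤n))
  prime≢2⇒3≤ {0} ()
  prime≢2⇒3≤ {1} ()

  2k+1≤3^k : ∀ k → 2 * k + 1 ≤ 3 ^ k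
  2k+1≤3^k zero = ≤-refl
  2k+1≤3^k (suc k) = begin
    2 * suc k + 1       ≡⟨ shuffle k ⟩
    (2 * k + 1) + 2     ≤⟨ +-mono-≤ (2k+1≤3^k k) (*-monoʳ-≤ 2 (m^n>0 3 k)) ⟩
    3 ^ k + 2 * 3 ^ k   ≡⟨ collect (3 ^ k) ⟩
    3 * 3 ^ k           ∎
    where
    shuffle : ∀ k → 2 * suc k + 1 ≡ (2 * k + 1) + 2
    shuffle = solve-∀
    collect : ∀ x → x + 2 * x ≡ 3 * x
    collect = solve-∀

  p^k∣u⇒3^k≤u : ∀ {p u} k → 3 ≤ p → p ^ k ∣ u → .{{NonZero u}} → 3 ^ k ≤ u
  p^k∣u⇒3^k≤u k 3≤p pᵏ∣u = ≤-trans (^-monoˡ-≤ k 3≤p) (∣⇒≤ pᵏ∣u)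

  p^k∣u⇒k+2≤u : ∀ {p u} → Prime p → p ≢ 2 → ∀ k → p ^ k ∣ u → 2 ≤ u → k + 2 ≤ u
  p^k∣u⇒k+2≤u _ _ zero _ 2≤u = 2≤u
  p^k∣u⇒k+2≤u {u = u@(suc _)} pr p≢2 (suc j) pᵏ∣u _ = begin
    suc j + 2           ≤⟨ m≤m+n (suc j + 2) j ⟩
    suc j + 2 + j       ≡⟨ shuffle j ⟩
    2 * suc j + 1       ≤⟨ 2k+1≤3^k (suc j) ⟩
    3 ^ suc j           ≤⟨ p^k∣u⇒3^k≤u (suc j) (prime≢2⇒3≤ pr p≢2) pᵏ∣u ⟩
    u                   ∎
    where
    shuffle : ∀ j → suc j + 2 + j ≡ 2 * suc j + 1
    shuffle = solve-∀

  prime∤⇒coprime : ∀ {p n} → Prime p → ¬ p ∣ n → Coprime p n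
  prime∤⇒coprime p-prime p∤n (d∣p , d∣n) with prime⇒irreducible p-prime d∣p
  ... | inj₁ d≡1 = d≡1
  ... | inj₂ refl = ⊥-elim (p∤n d∣n)

  prime∣prime⇒≡ : ∀ {p q} → Prime p → Prime q → p ∣ q → p ≡ q
  prime∣prime⇒≡ p-prime q-prime p∣q with prime⇒irreducible q-prime p∣q
  ... | inj₁ refl = ⊥-elim (¬prime[1] p-prime)
  ... | inj₂ p≡q = p≡q

  -- p ≠ 5 is needed only for k = 1, u = 5.
  p^k∣u⇒2k+4≤u : ∀ {p u} → Prime p → p ≢ 2 → p ≢ 5 → ∀ k → p ^ k ∣ u → 4 ≤ u → 2 * k + 4 ≤ u
  p^k∣u⇒2k+4≤u _ _ _ zero _ 4≤u = 4≤u
  p^k∣u⇒2k+4≤u {u = 1} _ _ _ 1 _ (s≤s ())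
  p^k∣u⇒2k+4≤u {u = 2} _ _ _ 1 _ (s≤s (s≤s ()))
  p^k∣u⇒2k+4≤u {u = 3} _ _ _ 1 _ (s≤s (s≤s (s≤s ())))
  p^k∣u⇒2k+4≤u {p} {4} pr p≢2 _ 1 p∣4 _ =
    ⊥-elim ([ p∤2 , p∤2 ]′ (euclidsLemma 2 2 pr (subst (_∣ 4) (*-identityʳ p) p∣4)))
    where
    p∤2 : ¬ p ∣ 2
    p∤2 = p≢2 ∘ prime∣prime⇒≡ pr prime[2]
  p^k∣u⇒2k+4≤u {p} {5} pr _ p≢5 1 p∣5 _ =
    ⊥-elim (p≢5 (prime∣prime⇒≡ pr (from-yes (prime? 5)) (subst (_∣ 5) (*-identityʳ p) p∣5)))
  p^k∣u⇒2k+4≤u {u = suc (suc (suc (suc (suc (suc _)))))} _ _ _ 1 _ _ = s≤s (s≤s (s≤s (s≤s (s≤s (s≤s z≤n)))))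
  p^k∣u⇒2k+4≤u {u = u@(suc _)} pr p≢2 _ (2+ j) pᵏ∣u _ = begin
    2 * (2 + j) + 4         ≤⟨ m≤m+n _ (16 * j + 1) ⟩
    2 * (2 + j) + 4 + (16 * j + 1) ≡⟨ shuffle j ⟩
    3 * (3 * (2 * j + 1))   ≤⟨ *-monoʳ-≤ 3 (*-monoʳ-≤ 3 (2k+1≤3^k j)) ⟩
    3 ^ (2 + j)             ≤⟨ p^k∣u⇒3^k≤u (2 + j) (prime≢2⇒3≤ pr p≢2) pᵏ∣u ⟩
    u                       ∎
    where
    shuffle : ∀ j → 2 * (2 + j) + 4 + (16 * j + 1) ≡ 3 * (3 * (2 * j + 1))
    shuffle = solve-∀

module _ where
  import Data.Nat as ℕ
  import Data.Nat.Properties as ℕ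
  open import Data.Integer as ℤ using (+_)
  import Data.Integer.Properties as ℤ
  open import Data.Rational using (mkℚ; _+_; _*_; -_; _≤_; _<_; nonNegative; toℚᵘ)
  open import Data.Rational.Properties
  import Data.Rational.Unnormalised as ℚᵘ
  import Data.Rational.Unnormalised.Properties as ℚᵘ
  open import Data.Nat.Coprimality as Coprime using (1-coprimeTo)
  open import Data.Rational.Solver using (module +-*-Solver)
  open +-*-Solver

  toℚᵘ-ℕ→ℚ : ∀ n → toℚᵘ (ℕ→ℚ n) ≡ ℚᵘ.mkℚᵘ (+ n) 0
  toℚᵘ-ℕ→ℚ n = cong toℚᵘ (↥p/↧p≡p (mkℚ (+ n) 0 (Coprime.sym (1-coprimeTo n))))

  ℕ→ℚ-+ : ∀ m n → ℕ→ℚ (m ℕ.+ n) ≡ ℕ→ℚ m + ℕ→ℚ n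
  ℕ→ℚ-+ m n = toℚᵘ-injective (begin
    toℚᵘ (ℕ→ℚ (m ℕ.+ n))                      ≡⟨ toℚᵘ-ℕ→ℚ (m ℕ.+ n) ⟩
    ℚᵘ.mkℚᵘ (+ (m ℕ.+ n)) 0                   ≈⟨ ℚᵘ.*≡* numerators ⟩
    ℚᵘ.mkℚᵘ (+ m) 0 ℚᵘ.+ ℚᵘ.mkℚᵘ (+ n) 0      ≡⟨ sym (cong₂ ℚᵘ._+_ (toℚᵘ-ℕ→ℚ m) (toℚᵘ-ℕ→ℚ n)) ⟩
    toℚᵘ (ℕ→ℚ m) ℚᵘ.+ toℚᵘ (ℕ→ℚ n)            ≈⟨ ℚᵘ.≃-sym (toℚᵘ-homo-+ (ℕ→ℚ m) (ℕ→ℚ n)) ⟩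
    toℚᵘ (ℕ→ℚ m + ℕ→ℚ n)                      ∎)
    where
    open ℚᵘ.≃-Reasoning
    numerators : + (m ℕ.+ n) ℤ.* + 1 ≡ (+ m ℤ.* + 1 ℤ.+ + n ℤ.* + 1) ℤ.* + 1
    numerators = trans (ℤ.*-identityʳ (+ (m ℕ.+ n))) (trans (ℤ.pos-+ m n) (sym (trans
      (ℤ.*-identityʳ (+ m ℤ.* + 1 ℤ.+ + n ℤ.* + 1))
      (cong₂ ℤ._+_ (ℤ.*-identityʳ (+ m)) (ℤ.*-identityʳ (+ n))))))

  ℕ→ℚ-mono-≤ : ∀ {m n} → m ℕ.≤ n → ℕ→ℚ m ≤ ℕ→ℚ n
  ℕ→ℚ-mono-≤ {m} {n} m≤n = toℚᵘ-cancel-≤ (subst₂ ℚᵘ._≤_ (sym (toℚᵘ-ℕ→ℚ m)) (sym (toℚᵘ-ℕ→ℚ n))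
    (ℚᵘ.*≤* (ℤ.*-monoʳ-≤-nonNeg (+ 1) (ℤ.+≤+ m≤n))))

  ℕ→ℚ-nonNeg : ∀ n → 0ℚ ≤ ℕ→ℚ n
  ℕ→ℚ-nonNeg n = ℕ→ℚ-mono-≤ {0} {n} ℕ.z≤n

  2k+1≤j⇒k<w*j : ∀ {w k j} → ½ ≤ w → 2 ℕ.* k ℕ.+ 1 ℕ.≤ j → ℕ→ℚ k < w * ℕ→ℚ j
  2k+1≤j⇒k<w*j {w} {k} {j} ½≤w 2k+1≤j = begin-strict
    K                   ≡⟨ sym (+-identityʳ K) ⟩
    K + 0ℚ              <⟨ +-monoʳ-< K (positive⁻¹ ½) ⟩
    K + ½               ≡⟨ halve K ⟩
    ½ * ((K + K) + 1ℚ)  ≡⟨ cong (½ *_) (sym ℕ→ℚ[2k+1]) ⟩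
    ½ * ℕ→ℚ (2 ℕ.* k ℕ.+ 1) ≤⟨ *-monoˡ-≤-nonNeg ½ (ℕ→ℚ-mono-≤ 2k+1≤j) ⟩
    ½ * ℕ→ℚ j           ≤⟨ *-monoʳ-≤-nonNeg (ℕ→ℚ j) {{nonNegative (ℕ→ℚ-nonNeg j)}} ½≤w ⟩
    w * ℕ→ℚ j           ∎
    where
    open ≤-Reasoning
    K = ℕ→ℚ k
    halve : ∀ K → K + ½ ≡ ½ * ((K + K) + 1ℚ)
    halve = solve 1 (λ K → K :+ con ½ := con ½ :* ((K :+ K) :+ con 1ℚ)) refl
    ℕ→ℚ[2k+1] : ℕ→ℚ (2 ℕ.* k ℕ.+ 1) ≡ (K + K) + 1ℚ
    ℕ→ℚ[2k+1] = begin-equality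
      ℕ→ℚ (2 ℕ.* k ℕ.+ 1)         ≡⟨ ℕ→ℚ-+ (2 ℕ.* k) 1 ⟩
      ℕ→ℚ (k ℕ.+ (k ℕ.+ 0)) + 1ℚ ≡⟨ cong (λ n → ℕ→ℚ (k ℕ.+ n) + 1ℚ) (ℕ.+-identityʳ k) ⟩
      ℕ→ℚ (k ℕ.+ k) + 1ℚ        ≡⟨ cong (_+ 1ℚ) (ℕ→ℚ-+ k k) ⟩
      (K + K) + 1ℚ              ∎

  k+1≤j⇒k<w*j : ∀ {w k j} → 1ℚ ≤ w → k ℕ.+ 1 ℕ.≤ j → ℕ→ℚ k < w * ℕ→ℚ j
  k+1≤j⇒k<w*j {w} {k} {j} 1≤w k+1≤j = begin-strict
    ℕ→ℚ k               ≡⟨ sym (+-identityʳ (ℕ→ℚ k)) ⟩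
    ℕ→ℚ k + 0ℚ          <⟨ +-monoʳ-< (ℕ→ℚ k) (positive⁻¹ 1ℚ) ⟩
    ℕ→ℚ k + 1ℚ          ≡⟨ sym (ℕ→ℚ-+ k 1) ⟩
    ℕ→ℚ (k ℕ.+ 1)       ≤⟨ ℕ→ℚ-mono-≤ k+1≤j ⟩
    ℕ→ℚ j               ≡⟨ sym (*-identityˡ (ℕ→ℚ j)) ⟩
    1ℚ * ℕ→ℚ j          ≤⟨ *-monoʳ-≤-nonNeg (ℕ→ℚ j) {{nonNegative (ℕ→ℚ-nonNeg j)}} 1≤w ⟩
    w * ℕ→ℚ j           ∎
    where open ≤-Reasoning

  k<x⇒0+y<-k+[y+x] : ∀ {k x} y → k < x → 0ℚ + y < - k + (y + x)
  k<x⇒0+y<-k+[y+x] {k} {x} y k<x = begin-strict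
    0ℚ + y              ≡⟨ cancel k y ⟩
    - k + (y + k)       <⟨ +-monoʳ-< (- k) (+-monoʳ-< y k<x) ⟩
    - k + (y + x)       ∎
    where
    open ≤-Reasoning
    cancel : ∀ k y → 0ℚ + y ≡ - k + (y + k)
    cancel = solve 2 (λ k y → con 0ℚ :+ y := :- k :+ (y :+ k)) refl

  p+p≡0⇒p≡0 : ∀ {q} → q + q ≡ 0ℚ → q ≡ 0ℚ
  p+p≡0⇒p≡0 {q} q+q≡0 with <-cmp q 0ℚ
  ... | tri< q<0 _ _ = ⊥-elim (<-irrefl q+q≡0 (+-mono-< q<0 q<0))
  ... | tri≈ _ q≡0 _ = q≡0
  ... | tri> _ _ q>0 = ⊥-elim (<-irrefl (sym q+q≡0) (+-mono-< q>0 q>0))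

module _ where
  open import Data.Rational using (_+_; -_; _<_)
  import Data.Rational.Properties as ℚ
  open import Algebra.Properties.Group ℚ.+-0-group using (identityˡ-unique; inverseʳ-unique)

  infix 4 _<∞_
  data _<∞_ : ℚ∞ → ℚ∞ → Set where
    fin<fin : ∀ {a b} → a < b → fin a <∞ fin b
    fin<∞   : ∀ {a} → fin a <∞ ∞

  fin-injective : ∀ {a b} → fin a ≡ fin b → a ≡ b
  fin-injective refl = refl

  ≤∞-refl : ∀ {x} → x ≤∞ x
  ≤∞-refl {fin a} = fin≤fin ℚ.≤-refl
  ≤∞-refl {∞}     = ∞ ≤∞∞

  ≤∞-trans : ∀ {x y z} → x ≤∞ y → y ≤∞ z → x ≤∞ z
  ≤∞-trans (fin≤fin a≤b) (fin≤fin b≤c) = fin≤fin (ℚ.≤-trans a≤b b≤c)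
  ≤∞-trans _             (_ ≤∞∞)       = _ ≤∞∞

  <∞-≤∞-trans : ∀ {x y z} → x <∞ y → y ≤∞ z → x <∞ z
  <∞-≤∞-trans (fin<fin a<b) (fin≤fin b≤c) = fin<fin (ℚ.<-≤-trans a<b b≤c)
  <∞-≤∞-trans (fin<fin _)   (_ ≤∞∞)       = fin<∞
  <∞-≤∞-trans fin<∞         (_ ≤∞∞)       = fin<∞

  ∞≰fin : ∀ {b} → ¬ ∞ ≤∞ fin b
  ∞≰fin ()

  <∞-irrefl : ∀ {a} → ¬ fin a <∞ fin a
  <∞-irrefl (fin<fin a<a) = ℚ.<-irrefl refl a<a

  ≤∞-min : ∀ {a y z} → fin a ≤∞ y → fin a ≤∞ z → fin a ≤∞ min∞ y z
  ≤∞-min (fin≤fin a≤b) (fin≤fin a≤c) = fin≤fin (ℚ.⊓-glb a≤b a≤c)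
  ≤∞-min (fin≤fin a≤b) (_ ≤∞∞)       = fin≤fin a≤b
  ≤∞-min (_ ≤∞∞)       a≤z           = a≤z

  <∞-min : ∀ {a y z} → fin a <∞ y → fin a <∞ z → fin a <∞ min∞ y z
  <∞-min {y = fin b} {fin c} (fin<fin a<b) (fin<fin a<c) with ℚ.⊓-sel b c
  ... | inj₁ b⊓c≡b = fin<fin (subst (_ <_) (sym b⊓c≡b) a<b)
  ... | inj₂ b⊓c≡c = fin<fin (subst (_ <_) (sym b⊓c≡c) a<c)
  <∞-min {y = fin _} a<y fin<∞ = a<y
  <∞-min {y = ∞}     _   a<z   = a<z

  +∞-mono-≤∞ : ∀ {x x′ y y′} → x ≤∞ x′ → y ≤∞ y′ → x +∞ y ≤∞ x′ +∞ y′
  +∞-mono-≤∞ (fin≤fin a≤b) (fin≤fin c≤d) = fin≤fin (ℚ.+-mono-≤ a≤b c≤d)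
  +∞-mono-≤∞ (fin≤fin _)   (_ ≤∞∞)       = _ ≤∞∞
  +∞-mono-≤∞ (_ ≤∞∞)       _             = _ ≤∞∞

  +∞-mono-≤∞-<∞ : ∀ {a b y z} → fin a ≤∞ y → fin b <∞ z → fin (a + b) <∞ y +∞ z
  +∞-mono-≤∞-<∞ (fin≤fin a≤c) (fin<fin b<d) = fin<fin (ℚ.+-mono-≤-< a≤c b<d)
  +∞-mono-≤∞-<∞ (fin≤fin _)   fin<∞         = fin<∞
  +∞-mono-≤∞-<∞ (_ ≤∞∞)       _             = fin<∞

  ≤∞-≮∞⇒≡ : ∀ {a x} → fin a ≤∞ x → ¬ fin a <∞ x → x ≡ fin a
  ≤∞-≮∞⇒≡ (fin≤fin a≤b) a≮b = cong fin (ℚ.≤-antisym (ℚ.≮⇒≥ (a≮b ∘ fin<fin)) a≤b)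
  ≤∞-≮∞⇒≡ (_ ≤∞∞)       a≮∞ = ⊥-elim (a≮∞ fin<∞)

  ≤∞-separated : ∀ {a b x y} → fin a ≤∞ x → y ≤∞ fin b → b < a → ¬ x ≤∞ y
  ≤∞-separated a≤x y≤b b<a x≤y with ≤∞-trans a≤x (≤∞-trans x≤y y≤b)
  ... | fin≤fin a≤b = ℚ.<-irrefl refl (ℚ.<-≤-trans b<a a≤b)

  +∞-identityˡ : ∀ x → fin 0ℚ +∞ x ≡ x
  +∞-identityˡ (fin a) = cong fin (ℚ.+-identityˡ a)
  +∞-identityˡ ∞       = refl

  +∞-idem⇒≡0 : ∀ x → x +∞ x ≡ x → x ≢ ∞ → x ≡ fin 0ℚ
  +∞-idem⇒≡0 (fin a) a+a≡a _ = cong fin (identityˡ-unique a a (fin-injective a+a≡a))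
  +∞-idem⇒≡0 ∞       _     ∞≢∞ = ⊥-elim (∞≢∞ refl)

  +∞-double≡0⇒≡0 : ∀ x → x +∞ x ≡ fin 0ℚ → x ≡ fin 0ℚ
  +∞-double≡0⇒≡0 (fin a) a+a≡0 = cong fin (p+p≡0⇒p≡0 (fin-injective a+a≡0))

  +∞-inverseʳ-unique : ∀ a y → fin a +∞ y ≡ fin 0ℚ → y ≡ fin (- a)
  +∞-inverseʳ-unique a (fin b) a+b≡0 = cong fin (inverseʳ-unique a b (fin-injective a+b≡0))

module _ {p c ℓ} (K : ValuedField p c ℓ) where
  open ValuedField K renaming (refl to ≈-refl; sym to ≈-sym; trans to ≈-trans)
  import Data.Nat as ℕ
  open import Data.Nat.Divisibility using (_∣_; _∣?_; divides; 1∣_; *-monoˡ-∣)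
  import Data.Nat.Properties as ℕ
  open import Data.Nat.Base using (NonZero; nonTrivial⇒n>1)
  open import Data.Nat.Coprimality using (coprime-Bézout)
  open import Data.Nat.Primality using (prime⇒nonTrivial)
  open import Data.Nat.GCD using (module Bézout)
  open import Data.Nat.Induction using (<-wellFounded)
  open import Induction.WellFounded using (Acc; acc)
  import Data.Rational as ℚ
  import Data.Rational.Properties as ℚ
  open import Algebra.Properties.Group +-group using (x≈z//y)
  open import Algebra.Properties.Ring ring using (-1*x≈-x; -‿involutive)
  open import Algebra.Definitions.RawMonoid +-rawMonoid using () renaming (_×_ to _×′_)
  open import Algebra.Properties.Semiring.Mult semiring using (×1-homo-*)
  import Relation.Binary.Reasoning.Setoid setoid as ≈-Reasoning

  ι≡×1# : ∀ n → ι cring n ≡ n ×′ 1#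
  ι≡×1# ℕ.zero    = refl
  ι≡×1# (ℕ.suc n) = cong (1# +_) (ι≡×1# n)

  ι-* : ∀ m n → ι cring (m ℕ.* n) ≈ ι cring m * ι cring n
  ι-* m n rewrite ι≡×1# (m ℕ.* n) | ι≡×1# m | ι≡×1# n = ×1-homo-* m n

  1#≈0#⇒≈0# : 1# ≈ 0# → ∀ x → x ≈ 0#
  1#≈0#⇒≈0# 1≈0 x = begin
    x       ≈⟨ ≈-sym (*-identityʳ x) ⟩
    x * 1#  ≈⟨ *-congˡ 1≈0 ⟩
    x * 0#  ≈⟨ zeroʳ x ⟩
    0#      ∎
    where open ≈-Reasoning

  v-1#≢∞ : v 1# ≢ ∞
  v-1#≢∞ v1≡∞ with trans (sym v-p) (trans (v-cong (1#≈0#⇒≈0# (v-zero 1# v1≡∞) (ι cring p))) v-0)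
  ... | ()

  v-1# : v 1# ≡ fin 0ℚ
  v-1# = +∞-idem⇒≡0 (v 1#) (trans (sym (v-mul 1# 1#)) (v-cong (*-identityˡ 1#))) v-1#≢∞

  v-neg : ∀ x → v (- x) ≡ v x
  v-neg x = begin
    v (- x)              ≡⟨ v-cong (≈-sym (-1*x≈-x x)) ⟩
    v (- 1# * x)         ≡⟨ v-mul (- 1#) x ⟩
    v (- 1#) +∞ v x      ≡⟨ cong (_+∞ v x) v-[-1#] ⟩
    fin 0ℚ +∞ v x        ≡⟨ +∞-identityˡ (v x) ⟩
    v x                  ∎
    where
    open ≡-Reasoning
    v-[-1#] : v (- 1#) ≡ fin 0ℚ
    v-[-1#] = +∞-double≡0⇒≡0 (v (- 1#)) (begin
      v (- 1#) +∞ v (- 1#) ≡⟨ sym (v-mul (- 1#) (- 1#)) ⟩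
      v (- 1# * - 1#)      ≡⟨ v-cong (≈-trans (-1*x≈-x (- 1#)) (-‿involutive 1#)) ⟩
      v 1#                 ≡⟨ v-1# ⟩
      fin 0ℚ               ∎)

  v-ι-nonneg : ∀ n → fin 0ℚ ≤∞ v (ι cring n)
  v-ι-nonneg ℕ.zero    = subst (fin 0ℚ ≤∞_) (sym v-0) (_ ≤∞∞)
  v-ι-nonneg (ℕ.suc n) =
    ≤∞-trans (≤∞-min (subst (fin 0ℚ ≤∞_) (sym v-1#) ≤∞-refl) (v-ι-nonneg n)) (v-add 1# (ι cring n))

  v-*-pos : ∀ {x y} → fin 0ℚ ≤∞ v x → fin 0ℚ <∞ v y → fin 0ℚ <∞ v (x * y)
  v-*-pos {x} {y} 0≤vx 0<vy = subst (fin 0ℚ <∞_) (sym (v-mul x y)) (+∞-mono-≤∞-<∞ 0≤vx 0<vy)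

  v-pos-difference : ∀ {x y z} → x + y ≈ z → fin 0ℚ <∞ v y → fin 0ℚ <∞ v z → fin 0ℚ <∞ v x
  v-pos-difference {x} {y} {z} x+y≈z 0<vy 0<vz = <∞-≤∞-trans
    (<∞-min 0<vz (subst (fin 0ℚ <∞_) (sym (v-neg y)) 0<vy))
    (subst (min∞ (v z) (v (- y)) ≤∞_) (v-cong (≈-sym (x≈z//y x y z x+y≈z))) (v-add z (- y)))

  v-ι-p-pos : fin 0ℚ <∞ v (ι cring p)
  v-ι-p-pos = subst (fin 0ℚ <∞_) (sym v-p) (fin<fin (ℚ.positive⁻¹ ℚ.1ℚ))

  v-ι-*-pos : ∀ m {n} → fin 0ℚ <∞ v (ι cring n) → fin 0ℚ <∞ v (ι cring (m ℕ.* n))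
  v-ι-*-pos m {n} 0<vn = subst (fin 0ℚ <∞_) (sym (v-cong (ι-* m n))) (v-*-pos (v-ι-nonneg m) 0<vn)

  -- ι (suc a) is 1# + ι a, so ultrametricity would give 0 < v 1#.
  v-ι-consecutive : ∀ {a b} → ℕ.suc a ≡ b → fin 0ℚ <∞ v (ι cring a) → fin 0ℚ <∞ v (ι cring b) → ⊥
  v-ι-consecutive sa≡b 0<va 0<vb =
    <∞-irrefl (subst (fin 0ℚ <∞_) v-1# (v-pos-difference (reflexive (cong (ι cring) sa≡b)) 0<va 0<vb))

  v-ι-pos⇒p∣ : Prime p → ∀ {n} → fin 0ℚ <∞ v (ι cring n) → p ∣ n
  v-ι-pos⇒p∣ p-prime {n} 0<vn with p ∣? n
  ... | yes p∣n = p∣n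
  ... | no p∤n with coprime-Bézout (prime∤⇒coprime p-prime p∤n)
  ...   | Bézout.+- x y 1+yn≡xp = ⊥-elim (v-ι-consecutive 1+yn≡xp (v-ι-*-pos y 0<vn) (v-ι-*-pos x v-ι-p-pos))
  ...   | Bézout.-+ x y 1+xp≡yn = ⊥-elim (v-ι-consecutive 1+xp≡yn (v-ι-*-pos x v-ι-p-pos) (v-ι-*-pos y 0<vn))

  v-ι : Prime p → ∀ n → .{{NonZero n}} → ∃[ k ] p ℕ.^ k ∣ n × v (ι cring n) ≡ fin (ℕ→ℚ k)
  v-ι p-prime n = go n (<-wellFounded n)
    where
    go : ∀ n → Acc ℕ._<_ n → .{{NonZero n}} → ∃[ k ] p ℕ.^ k ∣ n × v (ι cring n) ≡ fin (ℕ→ℚ k)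
    go n (acc smaller) with p ∣? n
    ... | no p∤n = 0 , 1∣ n , ≤∞-≮∞⇒≡ (v-ι-nonneg n) (p∤n ∘ v-ι-pos⇒p∣ p-prime)
    ... | yes (divides q refl) with go q (smaller q<qp) {{ℕ.m*n≢0⇒m≢0 q}}
      where
      q<qp : q ℕ.< q ℕ.* p
      q<qp = ℕ.m<m*n q p {{ℕ.m*n≢0⇒m≢0 q}} (nonTrivial⇒n>1 p {{prime⇒nonTrivial p-prime}})
    ...   | k , pᵏ∣q , vq≡k = ℕ.suc k , pᵏ⁺¹∣qp , v[qp]≡k+1
      where
      pᵏ⁺¹∣qp : p ℕ.^ ℕ.suc k ∣ q ℕ.* p
      pᵏ⁺¹∣qp = subst (_∣ q ℕ.* p) (ℕ.*-comm (p ℕ.^ k) p) (*-monoˡ-∣ p pᵏ∣q)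
      v[qp]≡k+1 : v (ι cring (q ℕ.* p)) ≡ fin (ℕ→ℚ (ℕ.suc k))
      v[qp]≡k+1 = begin
        v (ι cring (q ℕ.* p))               ≡⟨ v-cong (ι-* q p) ⟩
        v (ι cring q * ι cring p)           ≡⟨ v-mul _ _ ⟩
        v (ι cring q) +∞ v (ι cring p)      ≡⟨ cong₂ _+∞_ vq≡k v-p ⟩
        fin (ℕ→ℚ k ℚ.+ ℚ.1ℚ)               ≡⟨ cong fin (ℚ.+-comm (ℕ→ℚ k) ℚ.1ℚ) ⟩
        fin (ℚ.1ℚ ℚ.+ ℕ→ℚ k)               ≡⟨ cong fin (sym (ℕ→ℚ-+ 1 k)) ⟩
        fin (ℕ→ℚ (ℕ.suc k))                ∎
        where open ≡-Reasoning

  v-⁻¹ : ∀ {x a} → v x ≡ fin a → v (x ⁻¹) ≡ fin (ℚ.- a)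
  v-⁻¹ {x} {a} vx≡a = +∞-inverseʳ-unique a (v (x ⁻¹)) (begin
    fin a +∞ v (x ⁻¹)     ≡⟨ cong (_+∞ v (x ⁻¹)) (sym vx≡a) ⟩
    v x +∞ v (x ⁻¹)       ≡⟨ sym (v-mul x (x ⁻¹)) ⟩
    v (x * x ⁻¹)          ≡⟨ v-cong (inverse x x≉0) ⟩
    v 1#                  ≡⟨ v-1# ⟩
    fin 0ℚ                ∎)
    where
    open ≡-Reasoning
    x≉0 : x ≉ 0#
    x≉0 x≈0 with trans (sym vx≡a) (trans (v-cong x≈0) v-0)
    ... | ()

  v-antideriv : Prime p → ∀ a i →
    ∃[ k ] p ℕ.^ k ∣ ℕ.suc i × v (antideriv K a (ℕ.suc i)) ≡ v (a i) +∞ fin (ℚ.- ℕ→ℚ k)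
  v-antideriv p-prime a i with v-ι p-prime (ℕ.suc i)
  ... | k , pᵏ∣i+1 , v[i+1]≡k = k , pᵏ∣i+1 , trans (v-mul (a i) _) (cong (v (a i) +∞_) (v-⁻¹ v[i+1]≡k))

module _ {p c ℓ} (K : ValuedField p c ℓ) where
  open ValuedField K using (Carrier; v)
  import Data.Nat as ℕ
  import Data.Rational as ℚ
  import Data.Rational.Properties as ℚ

  Minimizes : ℚ → (ℕ → Carrier) → ℕ → Set
  Minimizes w F u = ∀ u″ → v (F u) +∞ wu K w u ≤∞ v (F u″) +∞ wu K w u″

  ∈New-antimono : ∀ {m m′ F x} → m ℚ.≤ m′ → _∈New[_]_ K x m′ F → _∈New[_]_ K x m F
  ∈New-antimono m≤m′ (u₁ , u₂ , (w₁ , m′≤w₁ , rest₁) , (w₂ , m′≤w₂ , rest₂) , u₁≤x , x≤u₂) =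
    u₁ , u₂ , (w₁ , ℚ.≤-trans m≤m′ m′≤w₁ , rest₁) , (w₂ , ℚ.≤-trans m≤m′ m′≤w₂ , rest₂) , u₁≤x , x≤u₂

  New⊆-antimono : ∀ {m m′ F a b} → m ℚ.≤ m′ → New⊆ K m F a b → New⊆ K m′ F a b
  New⊆-antimono m≤m′ New⊆[a,b] x = New⊆[a,b] x ∘ ∈New-antimono m≤m′

  New⊆-from-minimizers : ∀ {m F} lo hi → (∀ {w u} → m ℚ.≤ w → Minimizes w F u → lo ℕ.≤ u × u ℕ.≤ hi) →
    New⊆ K m F (ℕ→ℚ lo) (ℕ→ℚ hi)
  New⊆-from-minimizers lo hi bounds x (u₁ , u₂ , (_ , m≤w₁ , min₁ , _) , (_ , m≤w₂ , min₂ , _) , u₁≤x , x≤u₂) =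
    ℚ.≤-trans (ℕ→ℚ-mono-≤ (proj₁ (bounds m≤w₁ min₁))) u₁≤x ,
    ℚ.≤-trans x≤u₂ (ℕ→ℚ-mono-≤ (proj₂ (bounds m≤w₂ min₂)))

  -- The tie partner u′ in NewPt is itself a minimizer.
  NewEmpty-from-unique-minimizer : ∀ {m F} u₀ → (∀ {w u} → m ℚ.≤ w → Minimizes w F u → u ≡ u₀) → NewEmpty K m F
  NewEmpty-from-unique-minimizer {F = F} u₀ unique x (u , _ , (w , m≤w , min , u′ , u′≢u , tie) , _) =
    u′≢u (trans (unique m≤w min′) (sym (unique m≤w min)))
    where
    min′ : Minimizes w F u′
    min′ u″ = subst (_≤∞ v (F u″) +∞ wu K w u″) tie (min u″)

module Antiderivative {p c ℓ} (K : ValuedField p c ℓ) (p-prime : Prime p)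
                      (a : ℕ → ValuedField.Carrier K) (a-integral : ∀ i → fin 0ℚ ≤∞ ValuedField.v K (a i)) where
  open ValuedField K using (Carrier; v; v-0)
  open import Data.Nat as ℕ using (suc; zero; _^_; z≤n; s≤s; s≤s⁻¹)
  import Data.Nat.Properties as ℕ
  open import Data.Nat.Divisibility using (_∣_)
  open import Data.Nat.Tactic.RingSolver using (solve-∀)
  open import Data.Rational using (_+_; _*_; -_; _≤_; _<_)
  import Data.Rational.Properties as ℚ

  F : ℕ → Carrier
  F = antideriv K a

  v-F-lower : ∀ i → ∃[ k ] p ^ k ∣ suc i × fin (- ℕ→ℚ k) ≤∞ v (F (suc i))
  v-F-lower i with v-antideriv K p-prime a i
  ... | k , pᵏ∣i+1 , v[Fi+1]≡ = k , pᵏ∣i+1 ,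
    subst₂ _≤∞_ (cong fin (ℚ.+-identityˡ _)) (sym v[Fi+1]≡) (+∞-mono-≤∞ (a-integral i) ≤∞-refl)

  v-F-upper : ∀ {i} → v (a i) ≡ fin 0ℚ → v (F (suc i)) ≤∞ fin 0ℚ
  v-F-upper {i} unit with v-antideriv K p-prime a i
  ... | k , _ , v[Fi+1]≡ = subst (_≤∞ fin 0ℚ) (sym (trans v[Fi+1]≡ (trans (cong (_+∞ _) unit) (+∞-identityˡ _))))
    (fin≤fin (ℚ.neg-antimono-≤ (ℕ→ℚ-nonNeg k)))

  ¬Minimizes-0 : ∀ {i₀ w} → v (a i₀) ≡ fin 0ℚ → ¬ Minimizes K w F 0
  ¬Minimizes-0 {i₀} {w} unit min = ∞≰fin (≤∞-trans
    (subst (λ x → x +∞ wu K w 0 ≤∞ v (F (suc i₀)) +∞ wu K w (suc i₀)) v-0 (min (suc i₀)))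
    (+∞-mono-≤∞ (v-F-upper unit) ≤∞-refl))

  ¬Minimizes-beyond : ∀ {i₀ j w} → v (a i₀) ≡ fin 0ℚ → (∀ k → p ^ k ∣ suc i₀ ℕ.+ j → ℕ→ℚ k < w * ℕ→ℚ j) →
    ¬ Minimizes K w F (suc i₀ ℕ.+ j)
  ¬Minimizes-beyond {i₀} {j} {w} unit k<wj min with v-F-lower (i₀ ℕ.+ j)
  ... | k , pᵏ∣u , lower = ≤∞-separated
    (+∞-mono-≤∞ lower ≤∞-refl)
    (+∞-mono-≤∞ (v-F-upper unit) ≤∞-refl)
    (subst (0ℚ + w * ℕ→ℚ (suc i₀) <_) (cong (- ℕ→ℚ k +_) (sym w*[u₀+j]))
      (k<x⇒0+y<-k+[y+x] (w * ℕ→ℚ (suc i₀)) (k<wj k pᵏ∣u)))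
    (min (suc i₀))
    where
    w*[u₀+j] : w * ℕ→ℚ (suc i₀ ℕ.+ j) ≡ w * ℕ→ℚ (suc i₀) + w * ℕ→ℚ j
    w*[u₀+j] = trans (cong (w *_) (ℕ→ℚ-+ (suc i₀) j)) (ℚ.*-distribˡ-+ w _ _)

  minimizer-∈[1,3] : ∀ {i₀ w u} → p ≢ 2 → p ≢ 5 → i₀ ℕ.≤ 2 → v (a i₀) ≡ fin 0ℚ → ½ ≤ w →
    Minimizes K w F u → 1 ℕ.≤ u × u ℕ.≤ 3
  minimizer-∈[1,3] {i₀} {w} {zero} _ _ _ unit _ min = ⊥-elim (¬Minimizes-0 {i₀} {w} unit min)
  minimizer-∈[1,3] {i₀} {w} {suc i} p≢2 p≢5 i₀≤2 unit ½≤w min with i ℕ.≤? 2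
  ... | yes i≤2 = s≤s z≤n , s≤s i≤2
  ... | no i≰2 with ℕ.m≤n⇒∃[o]m+o≡n (ℕ.≤-trans i₀≤2 (ℕ.<⇒≤ (ℕ.≰⇒> i≰2)))
  ...   | j , refl = ⊥-elim (¬Minimizes-beyond {i₀} {j} {w} unit k<wj min)
    where
    k<wj : ∀ k → p ^ k ∣ suc i₀ ℕ.+ j → ℕ→ℚ k < w * ℕ→ℚ j
    k<wj k pᵏ∣u = 2k+1≤j⇒k<w*j {w} {k} {j} ½≤w (ℕ.+-cancelˡ-≤ 3 _ _ (begin
      3 ℕ.+ (2 ℕ.* k ℕ.+ 1)  ≡⟨ shuffle k ⟩
      2 ℕ.* k ℕ.+ 4          ≤⟨ p^k∣u⇒2k+4≤u p-prime p≢2 p≢5 k pᵏ∣u (s≤s (ℕ.≰⇒> i≰2)) ⟩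
      suc i₀ ℕ.+ j           ≤⟨ ℕ.+-monoˡ-≤ j (s≤s i₀≤2) ⟩
      3 ℕ.+ j                ∎))
      where
      open ℕ.≤-Reasoning
      shuffle : ∀ k → 3 ℕ.+ (2 ℕ.* k ℕ.+ 1) ≡ 2 ℕ.* k ℕ.+ 4
      shuffle = solve-∀

  minimizer≡1 : ∀ {w u} → p ≢ 2 → v (a 0) ≡ fin 0ℚ → 1ℚ ≤ w → Minimizes K w F u → u ≡ 1
  minimizer≡1 {w} {zero} _ unit _ min = ⊥-elim (¬Minimizes-0 {0} {w} unit min)
  minimizer≡1 {u = suc zero} _ _ _ _ = refl
  minimizer≡1 {w} {suc (suc j)} p≢2 unit 1≤w min = ⊥-elim (¬Minimizes-beyond {0} {suc j} {w} unit k<wj min)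
    where
    k<wj : ∀ k → p ^ k ∣ suc (suc j) → ℕ→ℚ k < w * ℕ→ℚ (suc j)
    k<wj k pᵏ∣u = k+1≤j⇒k<w*j {w} {k} {suc j} 1≤w
      (s≤s⁻¹ (subst (ℕ._≤ suc (suc j)) (ℕ.+-suc k 1) (p^k∣u⇒k+2≤u p-prime p≢2 k pᵏ∣u (s≤s (s≤s z≤n)))))

  New½⊆[1,3] : ∀ {i₀} → p ≢ 2 → p ≢ 5 → i₀ ℕ.≤ 2 → v (a i₀) ≡ fin 0ℚ → New⊆ K ½ F 1ℚ (ℕ→ℚ 3)
  New½⊆[1,3] p≢2 p≢5 i₀≤2 unit = New⊆-from-minimizers K 1 3 (minimizer-∈[1,3] p≢2 p≢5 i₀≤2 unit)

  New₁-empty : p ≢ 2 → v (a 0) ≡ fin 0ℚ → NewEmpty K 1ℚ F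
  New₁-empty p≢2 unit = NewEmpty-from-unique-minimizer K 1 (minimizer≡1 p≢2 unit)

lemma6p2 : {c ℓ : Level} (p : ℕ) → Prime p → p ≢ 2 → p ≢ 5
    → (K : ValuedField p c ℓ) → (a : ℕ → ValuedField.Carrier K)
    → (∀ i → fin 0ℚ ≤∞ ValuedField.v K (a i))
    → ((ValuedField.v K (a 0) ≡ fin 0ℚ)
    → NewEmpty K 1ℚ (antideriv K a) × New⊆ K ½ (antideriv K a) 1ℚ (ℕ→ℚ 3))
    × ((ValuedField.v K (a 1) ≡ fin 0ℚ ⊎ ValuedField.v K (a 2) ≡ fin 0ℚ)
    → New⊆ K 1ℚ (antideriv K a) 1ℚ (ℕ→ℚ 3) × New⊆ K ½ (antideriv K a) 1ℚ (ℕ→ℚ 3))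
lemma6p2 p p-prime p≢2 p≢5 K a a-integral =
  (λ unit₀ → New₁-empty p≢2 unit₀ , New½⊆[1,3] p≢2 p≢5 z≤n unit₀) ,
  [ New₁,New½⊆[1,3] (s≤s z≤n) , New₁,New½⊆[1,3] (s≤s (s≤s z≤n)) ]′
  where
  open Antiderivative K p-prime a a-integral
  open import Data.Nat using (_≤_; z≤n; s≤s)
  open import Data.Rational.Properties using (_≤?_)
  open import Relation.Nullary.Decidable using (from-yes)

  New₁,New½⊆[1,3] : ∀ {i₀} → i₀ ≤ 2 → ValuedField.v K (a i₀) ≡ fin 0ℚ →
    New⊆ K 1ℚ F 1ℚ (ℕ→ℚ 3) × New⊆ K ½ F 1ℚ (ℕ→ℚ 3)
  New₁,New½⊆[1,3] i₀≤2 unit =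
    New⊆-antimono K (from-yes (½ ≤? 1ℚ)) (New½⊆[1,3] p≢2 p≢5 i₀≤2 unit) , New½⊆[1,3] p≢2 p≢5 i₀≤2 unit
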